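{- Let $P=[a_1]\times[a_2]\times[a_3]$ and $I\in J(P)$. Then $\mathrm{Pro}_{(1,1,-1)}(\Delta^3_{(1,1,1)}I)=\Delta^3_{(1,1,1)}(\mathrm{Pro}_{(1,1,1)}(I))$.
   Context: $[m]=\{1,\dots,m\}$; $P$ has the componentwise order, elements viewed as vectors in $\mathbb{Z}^3$; $J(P)$ is the set of order ideals. The toggle $t_e(I)$ is $I\cup\{e\}$ if $e\notin I$ and this is an order ideal, $I\setminus\{e\}$ if $e\in I$ and this is an order ideal, and $I$ otherwise. For $w\in\{\pm1\}^3$, $T^i_w$ is the (commuting) product of toggles $t_x$ over $x\in P$ with $\langle x,w\rangle=i$, and $\mathrm{Pro}_w=\cdots T^{ -1}_wT^0_wT^1_w\cdots$ applies the $T^i_w$ in decreasing order of $i$ ($\mathrm{Pro}_{(1,1,1)}$ is rowmotion). For $I\in J(P)$, $L^j_\gamma(I)=\{x\in I:x_\gamma=j\}$ and $\Delta^\gamma_v I=\bigcup_{j=1}^{a_\gamma}L^j_\gamma(\mathrm{Pro}_v^{j-1}(I))$. -}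

module Defs where

open import Data.Bool using (Bool; true; false; _∧_; _∨_; not; if_then_else_)
open import Data.Nat as ℕ using (ℕ; zero; suc)
open import Data.Fin as Fin using (Fin; toℕ)
open import Data.Integer as ℤ using (ℤ; +_; -_)
open import Data.Bool.ListAction using (all; any)
open import Data.List using (List; []; _∷_; foldr; map; upTo; allFin; concatMap)
open import Data.Product using (_×_; _,_)
open import Data.Sign using (Sign)
open import Relation.Binary.PropositionalEquality using (_≡_)
open import Relation.Nullary.Decidable using (⌊_⌋)

record SignVec : Set where
  constructor ⟨_,_,_⟩
  field s₁ s₂ s₃ : Sign

signℤ : Sign → ℤ
signℤ Sign.+ = + 1
signℤ Sign.- = - (+ 1)

-- Coordinate indices γ ∈ {1,2,3} are represented by Fin 3 (0 ↦ 1, 1 ↦ 2, 2 ↦ 3).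

module Box (a₁ a₂ a₃ : ℕ) where

  -- An element x ∈ P; the Fin index i stands for the value i+1 ∈ [aᵢ].
  Pt : Set
  Pt = Fin a₁ × Fin a₂ × Fin a₃

  coord : Fin 3 → Pt → ℕ
  coord Fin.zero (x , _ , _) = suc (toℕ x)
  coord (Fin.suc Fin.zero) (_ , y , _) = suc (toℕ y)
  coord (Fin.suc (Fin.suc Fin.zero)) (_ , _ , z) = suc (toℕ z)

  size : Fin 3 → ℕ
  size Fin.zero = a₁
  size (Fin.suc Fin.zero) = a₂
  size (Fin.suc (Fin.suc Fin.zero)) = a₃

  elems : List Pt
  elems = concatMap (λ x → concatMap (λ y → map (λ z → (x , y , z)) (allFin a₃)) (allFin a₂)) (allFin a₁)

  _≤P_ : Pt → Pt → Set
  (x₁ , x₂ , x₃) ≤P (y₁ , y₂ , y₃) = (toℕ x₁ ℕ.≤ toℕ y₁) × (toℕ x₂ ℕ.≤ toℕ y₂) × (toℕ x₃ ℕ.≤ toℕ y₃)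

  _≤ᵇ_ : Pt → Pt → Bool
  (x₁ , x₂ , x₃) ≤ᵇ (y₁ , y₂ , y₃) = ⌊ toℕ x₁ ℕ.≤? toℕ y₁ ⌋ ∧ ⌊ toℕ x₂ ℕ.≤? toℕ y₂ ⌋ ∧ ⌊ toℕ x₃ ℕ.≤? toℕ y₃ ⌋

  _≟P_ : Pt → Pt → Bool
  x ≟P y = (x ≤ᵇ y) ∧ (y ≤ᵇ x)

  Subset : Set
  Subset = Pt → Bool

  IsOrderIdeal : Subset → Set
  IsOrderIdeal S = ∀ x y → x ≤P y → S y ≡ true → S x ≡ true

  isOrderIdealᵇ : Subset → Bool
  isOrderIdealᵇ S = all (λ y → all (λ x → not (x ≤ᵇ y ∧ S y) ∨ S x) elems) elems

  insert remove : Pt → Subset → Subset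
  insert e S x = S x ∨ (x ≟P e)
  remove e S x = S x ∧ not (x ≟P e)

  toggle : Pt → Subset → Subset
  toggle e S with S e
  ... | false = if isOrderIdealᵇ (insert e S) then insert e S else S
  ... | true  = if isOrderIdealᵇ (remove e S) then remove e S else S

  inner : Pt → SignVec → ℤ
  inner x ⟨ s₁ , s₂ , s₃ ⟩ =
    (+ coord Fin.zero x ℤ.* signℤ s₁) ℤ.+ (+ coord (Fin.suc Fin.zero) x ℤ.* signℤ s₂)
      ℤ.+ (+ coord (Fin.suc (Fin.suc Fin.zero)) x ℤ.* signℤ s₃)

  -- T^i_w : product of the toggles t_x over x ∈ P with ⟨x,w⟩ = i
  -- (applied one after another in the enumeration order of elems; these toggles commute).
  T : SignVec → ℤ → Subset → Subset
  T w i S = foldr (λ x R → if ⌊ inner x w ℤ.≟ i ⌋ then toggle x R else R) S elems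

  -- bound N with |⟨x,w⟩| ≤ N for all x ∈ P
  N : ℕ
  N = a₁ ℕ.+ a₂ ℕ.+ a₃

  -- Pro_w : apply T^i_w for i = N, N-1, …, -N (decreasing i); levels outside
  -- this range are empty, so T^i_w is the identity there.
  Pro : SignVec → Subset → Subset
  Pro w S = foldr (λ k R → T w (+ k ℤ.- + N) R) S (upTo (suc (2 ℕ.* N)))
  -- foldr applies the head (k = 0, i.e. i = -N) last, so i = N is applied first.

  iter : ℕ → (Subset → Subset) → Subset → Subset
  iter zero f S = S
  iter (suc n) f S = f (iter n f S)

  L : Fin 3 → ℕ → Subset → Subset
  L γ j S x = S x ∧ ⌊ coord γ x ℕ.≟ j ⌋

  Δ : Fin 3 → SignVec → Subset → Subset
  Δ γ v S x = any (λ k → L γ (suc k) (iter k (Pro v) S) x) (upTo (size γ))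

  _≐_ : Subset → Subset → Set
  S ≐ R = ∀ x → S x ≡ R x

-- Pro_w toggles the levels ⟨x,w⟩ = i from the top down, and points of one level are never
-- covers of each other, so y ∈ Pro_w(A) is decided by toggling y in an order ideal that agrees
-- with Pro_w(A) on the neighbours of y one w-level higher and with A on its other neighbours.
-- Δ = Δ³_(1,1,1) puts Pro_(1,1,1)^j(I) on the slice x₃ = j + 1; it is an order ideal because
-- rowmotion keeps everything strictly below a new element. By downward induction on the
-- (1,1,-1)-level of y, the local descriptions of y ∈ Pro_(1,1,-1)(Δ I) and y ∈ Δ(Pro_(1,1,1) I)
-- agree: neighbours of y in the first two directions sit at the same relative level for both
-- sign vectors, and in the third direction the reversed level of (1,1,-1) is matched by the
-- slice shift j ↦ j ± 1 built into Δ.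

module Submission where

open import Defs
open import Data.Bool using (Bool; true; false; _∧_; _∨_; not; if_then_else_)
open import Data.Bool.Properties using (⇔→≡; ∨-zeroʳ; ∧-zeroʳ; ∨-identityʳ; ∧-identityʳ)
open import Data.Bool.ListAction using (all; any)
open import Data.Empty using (⊥-elim)
open import Data.Fin as Fin using (Fin; toℕ)
import Data.Fin.Properties as Finₚ
open import Data.Integer as ℤ using (ℤ; +_; -_)
import Data.Integer.Properties as ℤₚ
open import Algebra.Properties.AbelianGroup ℤₚ.+-0-abelianGroup using (∙-cancelʳ)
open import Data.Integer.Tactic.RingSolver using (solve-∀)
open import Data.List using (List; []; _∷_; foldr; map; upTo; allFin; concatMap)
open import Data.List.Membership.Propositional using (_∈_; _∉_)
import Data.List.Membership.Propositional.Properties as ∈ₚ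
import Data.List.Relation.Unary.All as All
import Data.List.Relation.Unary.All.Properties as Allₚ
open import Data.List.Relation.Unary.AllPairs as AllPairs using (AllPairs; _∷_)
import Data.List.Relation.Unary.AllPairs.Properties as AllPairsₚ
open import Data.List.Relation.Unary.Any as Any using (here; there)
open import Data.List.Relation.Unary.Unique.Propositional using (Unique)
import Data.List.Relation.Unary.Unique.Propositional.Properties as Uniqueₚ
open import Data.Nat as ℕ using (ℕ; zero; suc; pred; _+_; _∸_; _≤_; _<_; z≤n; s≤s)
import Data.Nat.Properties as ℕₚ
import Data.Nat.Tactic.RingSolver as ℕSolver
open import Data.Product using (Σ-syntax; ∃; _×_; _,_; proj₁; proj₂)
open import Data.Product.Properties using (≡-dec)
open import Data.Sign using (Sign)
open import Data.Sum using (_⊎_; inj₁; inj₂)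
open import Function using (_⇔_; mk⇔; Equivalence; id)
import Function.Properties.Equivalence as ⇔
open import Relation.Binary.Definitions using (DecidableEquality)
open import Relation.Binary.PropositionalEquality
open import Relation.Nullary using (¬_; Dec; yes; no)
open import Relation.Nullary.Decidable using (⌊_⌋)

all-≡true⁻ : ∀ {A : Set} (p : A → Bool) {xs} → all p xs ≡ true → ∀ {x} → x ∈ xs → p x ≡ true
all-≡true⁻ p {y ∷ _} h (here refl) with p y | h
... | true | _ = refl
all-≡true⁻ p {y ∷ _} h (there x∈) with p y | h
... | true | h′ = all-≡true⁻ p h′ x∈

all-≡true⁺ : ∀ {A : Set} (p : A → Bool) xs → (∀ {x} → x ∈ xs → p x ≡ true) → all p xs ≡ true
all-≡true⁺ p [] h = refl
all-≡true⁺ p (y ∷ xs) h rewrite h (here refl) = all-≡true⁺ p xs (λ x∈ → h (there x∈))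

any-≡true⁻ : ∀ {A : Set} (p : A → Bool) xs → any p xs ≡ true → ∃ λ x → x ∈ xs × p x ≡ true
any-≡true⁻ p (y ∷ xs) h with p y in py
... | true = y , here refl , py
... | false with any-≡true⁻ p xs h
...   | x , x∈ , px = x , there x∈ , px

any-≡true⁺ : ∀ {A : Set} (p : A → Bool) {xs x} → x ∈ xs → p x ≡ true → any p xs ≡ true
any-≡true⁺ p (here refl) px rewrite px = refl
any-≡true⁺ p {y ∷ _} (there x∈) px with p y
... | true = refl
... | false = any-≡true⁺ p x∈ px

Unique-concatMap⁺ : ∀ {A B : Set} {f : A → List B} {xs} → Unique xs → (∀ x → Unique (f x)) →
  (∀ {x x′ y} → y ∈ f x → y ∈ f x′ → x ≡ x′) → Unique (concatMap f xs)
Unique-concatMap⁺ {f = f} {xs} xs! f! separated =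
  Uniqueₚ.concat⁺ (Allₚ.map⁺ (All.universal f! xs))
    (AllPairsₚ.map⁺ (AllPairs.map (λ x≢x′ {_} (y∈ , y∈′) → x≢x′ (separated y∈ y∈′)) xs!))

any-upTo-select : ∀ (f : ℕ → Bool) {c n} → 0 < c → c ≤ n →
  any (λ k → f k ∧ ⌊ c ℕ.≟ suc k ⌋) (upTo n) ≡ f (pred c)
any-upTo-select f {suc t} {n} _ c≤n = ⇔→≡ (mk⇔ select (λ ft → any-≡true⁺ _ (∈ₚ.∈-upTo⁺ c≤n) (selected ft)))
  where
  select : any (λ k → f k ∧ ⌊ suc t ℕ.≟ suc k ⌋) (upTo n) ≡ true → f t ≡ true
  select h with any-≡true⁻ _ (upTo n) h
  ... | k , _ , fk∧ with f k in fk | suc t ℕ.≟ suc k | fk∧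
  ...   | true | yes refl | _ = fk
  ...   | true | no _ | ()
  ...   | false | _ | ()
  selected : f t ≡ true → (f t ∧ ⌊ suc t ℕ.≟ suc t ⌋) ≡ true
  selected ft rewrite ft with suc t ℕ.≟ suc t
  ... | yes _ = refl
  ... | no t≢t = ⊥-elim (t≢t refl)

∨-not-∧⇒ : ∀ {b c d} → (not (b ∧ c) ∨ d) ≡ true → b ≡ true → c ≡ true → d ≡ true
∨-not-∧⇒ h refl refl = h

⇒∨-not-∧ : ∀ {b c d} → (b ≡ true → c ≡ true → d ≡ true) → (not (b ∧ c) ∨ d) ≡ true
⇒∨-not-∧ {false} h = refl
⇒∨-not-∧ {true} {false} h = refl
⇒∨-not-∧ {true} {true} h = h refl refl

⌊⌋-true : ∀ {A : Set} (d : Dec A) → A → ⌊ d ⌋ ≡ true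
⌊⌋-true (yes _) _ = refl
⌊⌋-true (no ¬a) a = ⊥-elim (¬a a)

⌊⌋-false : ∀ {A : Set} (d : Dec A) → ¬ A → ⌊ d ⌋ ≡ false
⌊⌋-false (yes a) ¬a = ⊥-elim (¬a a)
⌊⌋-false (no _) _ = refl

∨-introˡ : ∀ {b c} → b ≡ true → b ∨ c ≡ true
∨-introˡ refl = refl

∨-introʳ : ∀ {b c} → c ≡ true → b ∨ c ≡ true
∨-introʳ {b} refl = ∨-zeroʳ b

∨-falseʳ : ∀ {b c} → b ∨ c ≡ true → c ≡ false → b ≡ true
∨-falseʳ {b} h refl = trans (sym (∨-identityʳ b)) h

∧-elim : ∀ {b c} → b ∧ c ≡ true → b ≡ true × c ≡ true
∧-elim {true} h = refl , h

suc≡⇒≤ : ∀ {m n} → n ≡ suc m → m ≤ n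
suc≡⇒≤ refl = ℕₚ.n≤1+n _

successor-below : ∀ {n} (i k : Fin n) → toℕ i < toℕ k → Σ[ j ∈ Fin n ] toℕ j ≡ suc (toℕ i) × toℕ j ≤ toℕ k
successor-below i k i<k = Fin.fromℕ< i+1<n , Finₚ.toℕ-fromℕ< i+1<n ,
  subst (_≤ toℕ k) (sym (Finₚ.toℕ-fromℕ< i+1<n)) i<k
  where i+1<n = ℕₚ.≤-<-trans i<k (Finₚ.toℕ<n k)

predecessor-above : ∀ {n} (i k : Fin n) → toℕ i < toℕ k → Σ[ j ∈ Fin n ] toℕ k ≡ suc (toℕ j) × toℕ i ≤ toℕ j
predecessor-above i (Fin.suc j) (s≤s i≤j) =
  Fin.inject₁ j , cong suc (sym (Finₚ.toℕ-inject₁ j)) , subst (_ ≤_) (sym (Finₚ.toℕ-inject₁ j)) i≤j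

shift : Sign → ℕ → ℕ → ℕ
shift Sign.+ c a = a + c
shift Sign.- c a = a ∸ c

shift-signℤ : ∀ s {c a} → c ≤ a → + shift s c a ℤ.- + a ≡ + c ℤ.* signℤ s
shift-signℤ Sign.+ {c} {a} _ = begin
  + (a + c) ℤ.- + a      ≡⟨ cong (ℤ._- + a) (ℤₚ.pos-+ a c) ⟩
  (+ a ℤ.+ + c) ℤ.- + a  ≡⟨ a+c-a≡c (+ a) (+ c) ⟩
  + c ℤ.* + 1            ∎
  where
  open ≡-Reasoning
  a+c-a≡c : ∀ (a c : ℤ) → (a ℤ.+ c) ℤ.- a ≡ c ℤ.* + 1
  a+c-a≡c = solve-∀
shift-signℤ Sign.- {c} {a} c≤a = begin
  + (a ∸ c) ℤ.- + a                   ≡⟨ cong (λ t → + (a ∸ c) ℤ.- + t) (sym (ℕₚ.m∸n+n≡m c≤a)) ⟩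
  + (a ∸ c) ℤ.- + (a ∸ c + c)         ≡⟨ cong (λ t → + (a ∸ c) ℤ.- t) (ℤₚ.pos-+ (a ∸ c) c) ⟩
  + (a ∸ c) ℤ.- (+ (a ∸ c) ℤ.+ + c)   ≡⟨ d-[d+c]≡-c (+ (a ∸ c)) (+ c) ⟩
  + c ℤ.* - (+ 1)                     ∎
  where
  open ≡-Reasoning
  d-[d+c]≡-c : ∀ (d c : ℤ) → d ℤ.- (d ℤ.+ c) ≡ c ℤ.* - (+ 1)
  d-[d+c]≡-c = solve-∀

shift≤ : ∀ s {c a} → c ≤ a → shift s c a ≤ a + a
shift≤ Sign.+ {a = a} c≤a = ℕₚ.+-monoʳ-≤ a c≤a
shift≤ Sign.- {c} {a} _ = ℕₚ.≤-trans (ℕₚ.m∸n≤m a c) (ℕₚ.m≤m+n a a)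

Step : Sign → ℕ → ℕ → Set
Step Sign.+ m n = n ≡ suc m
Step Sign.- m n = m ≡ suc n

Step-adjacent : ∀ s {m n} → Step s m n → n ≡ suc m ⊎ m ≡ suc n
Step-adjacent Sign.+ = inj₁
Step-adjacent Sign.- = inj₂

Step-+ʳ : ∀ s {m n} k → Step s m n → Step s (m + k) (n + k)
Step-+ʳ Sign.+ k e = cong (ℕ._+ k) e
Step-+ʳ Sign.- k e = cong (ℕ._+ k) e

Step-+ˡ : ∀ s {m n} k → Step s m n → Step s (k + m) (k + n)
Step-+ˡ Sign.+ {m} k e = trans (cong (k ℕ.+_) e) (ℕₚ.+-suc k m)
Step-+ˡ Sign.- {n = n} k e = trans (cong (k ℕ.+_) e) (ℕₚ.+-suc k n)

shift-Step : ∀ s {n} {i j : Fin n} → toℕ j ≡ suc (toℕ i) →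
  Step s (shift s (suc (toℕ i)) n) (shift s (suc (toℕ j)) n)
shift-Step Sign.+ {n} {i} e rewrite e = ℕₚ.+-suc n (suc (toℕ i))
shift-Step Sign.- {n} {j = j} e rewrite sym e = ℕₚ.+-∸-assoc 1 (Finₚ.toℕ<n j)

module Properties (a₁ a₂ a₃ : ℕ) where
  open Box a₁ a₂ a₃

  Pt-≡ : ∀ {x₁ y₁ : Fin a₁} {x₂ y₂ : Fin a₂} {x₃ y₃ : Fin a₃} →
    toℕ x₁ ≡ toℕ y₁ → toℕ x₂ ≡ toℕ y₂ → toℕ x₃ ≡ toℕ y₃ → (x₁ , x₂ , x₃) ≡ (y₁ , y₂ , y₃)
  Pt-≡ e₁ e₂ e₃ =
    cong₂ _,_ (Finₚ.toℕ-injective e₁) (cong₂ _,_ (Finₚ.toℕ-injective e₂) (Finₚ.toℕ-injective e₃))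

  _≟Pt_ : DecidableEquality Pt
  _≟Pt_ = ≡-dec Fin._≟_ (≡-dec Fin._≟_ Fin._≟_)

  ≤P-refl : ∀ {x} → x ≤P x
  ≤P-refl = ℕₚ.≤-refl , ℕₚ.≤-refl , ℕₚ.≤-refl

  ≤P-trans : ∀ {x y z} → x ≤P y → y ≤P z → x ≤P z
  ≤P-trans (p₁ , p₂ , p₃) (q₁ , q₂ , q₃) = ℕₚ.≤-trans p₁ q₁ , ℕₚ.≤-trans p₂ q₂ , ℕₚ.≤-trans p₃ q₃

  ≤P-antisym : ∀ {x y} → x ≤P y → y ≤P x → x ≡ y
  ≤P-antisym (p₁ , p₂ , p₃) (q₁ , q₂ , q₃) =
    Pt-≡ (ℕₚ.≤-antisym p₁ q₁) (ℕₚ.≤-antisym p₂ q₂) (ℕₚ.≤-antisym p₃ q₃)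

  ≤ᵇ⇒≤P : ∀ x y → (x ≤ᵇ y) ≡ true → x ≤P y
  ≤ᵇ⇒≤P (x₁ , x₂ , x₃) (y₁ , y₂ , y₃) h
    with toℕ x₁ ℕ.≤? toℕ y₁ | toℕ x₂ ℕ.≤? toℕ y₂ | toℕ x₃ ℕ.≤? toℕ y₃ | h
  ... | yes p₁ | yes p₂ | yes p₃ | _ = p₁ , p₂ , p₃
  ... | yes _  | yes _  | no _   | ()
  ... | yes _  | no _   | _      | ()
  ... | no _   | _      | _      | ()

  ≤P⇒≤ᵇ : ∀ x y → x ≤P y → (x ≤ᵇ y) ≡ true
  ≤P⇒≤ᵇ (x₁ , x₂ , x₃) (y₁ , y₂ , y₃) (p₁ , p₂ , p₃)
    with toℕ x₁ ℕ.≤? toℕ y₁ | toℕ x₂ ℕ.≤? toℕ y₂ | toℕ x₃ ℕ.≤? toℕ y₃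
  ... | yes _ | yes _ | yes _ = refl
  ... | yes _ | yes _ | no ¬p₃ = ⊥-elim (¬p₃ p₃)
  ... | yes _ | no ¬p₂ | _ = ⊥-elim (¬p₂ p₂)
  ... | no ¬p₁ | _ | _ = ⊥-elim (¬p₁ p₁)

  ≟P-refl : ∀ x → (x ≟P x) ≡ true
  ≟P-refl x rewrite ≤P⇒≤ᵇ x x ≤P-refl = refl

  ≟P⇒≡ : ∀ x y → (x ≟P y) ≡ true → x ≡ y
  ≟P⇒≡ x y h with x ≤ᵇ y in x≤y | y ≤ᵇ x in y≤x | h
  ... | true | true | _ = ≤P-antisym (≤ᵇ⇒≤P x y x≤y) (≤ᵇ⇒≤P y x y≤x)

  ≢⇒≟P : ∀ x y → x ≢ y → (x ≟P y) ≡ false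
  ≢⇒≟P x y x≢y with x ≟P y in h
  ... | true = ⊥-elim (x≢y (≟P⇒≡ x y h))
  ... | false = refl

  not-≟P⇒≢ : ∀ y x → not (y ≟P x) ≡ true → y ≢ x
  not-≟P⇒≢ y .y h refl with y ≟P y | ≟P-refl y | h
  ... | true | _ | ()

  ∈-elems : ∀ x → x ∈ elems
  ∈-elems (x₁ , x₂ , x₃) =
    ∈ₚ.∈-concatMap⁺ _ (Any.map (λ { refl → ∈ₚ.∈-concatMap⁺ _
      (Any.map (λ { refl → ∈ₚ.∈-map⁺ _ (∈ₚ.∈-allFin x₃) }) (∈ₚ.∈-allFin x₂)) }) (∈ₚ.∈-allFin x₁))

  elems-unique : Unique elems
  elems-unique = Unique-concatMap⁺ (Uniqueₚ.allFin⁺ a₁)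
    (λ x₁ → Unique-concatMap⁺ (Uniqueₚ.allFin⁺ a₂)
      (λ x₂ → Uniqueₚ.map⁺ (λ { refl → refl }) (Uniqueₚ.allFin⁺ a₃))
      (λ y∈ y∈′ → trans (sym (proj₂ (∈-line y∈))) (proj₂ (∈-line y∈′))))
    (λ y∈ y∈′ → trans (sym (∈-plane y∈)) (∈-plane y∈′))
    where
    ∈-line : ∀ {x₁ x₂ y} → y ∈ map (λ x₃ → (x₁ , x₂ , x₃)) (allFin a₃) → proj₁ y ≡ x₁ × proj₁ (proj₂ y) ≡ x₂
    ∈-line y∈ with ∈ₚ.∈-map⁻ _ y∈
    ... | _ , _ , refl = refl , refl
    ∈-plane : ∀ {x₁ y} → y ∈ concatMap (λ x₂ → map (λ x₃ → (x₁ , x₂ , x₃)) (allFin a₃)) (allFin a₂) →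
      proj₁ y ≡ x₁
    ∈-plane y∈ = proj₁ (∈-line (proj₂ (Any.satisfied (∈ₚ.∈-concatMap⁻ _ {xs = allFin a₂} y∈))))

  isOrderIdealᵇ-reflects : ∀ S → isOrderIdealᵇ S ≡ true ⇔ IsOrderIdeal S
  isOrderIdealᵇ-reflects S = mk⇔
    (λ h x y x≤y Sy → ∨-not-∧⇒ (all-≡true⁻ _ (all-≡true⁻ _ h (∈-elems y)) (∈-elems x)) (≤P⇒≤ᵇ x y x≤y) Sy)
    (λ ideal → all-≡true⁺ _ elems λ {y} _ → all-≡true⁺ _ elems λ {x} _ →
      ⇒∨-not-∧ (λ x≤y Sy → ideal x y (≤ᵇ⇒≤P x y x≤y) Sy))

  _⋖[_]_ : Pt → Fin 3 → Pt → Set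
  (x₁ , x₂ , x₃) ⋖[ Fin.zero ] (y₁ , y₂ , y₃) = toℕ y₁ ≡ suc (toℕ x₁) × x₂ ≡ y₂ × x₃ ≡ y₃
  (x₁ , x₂ , x₃) ⋖[ Fin.suc Fin.zero ] (y₁ , y₂ , y₃) = x₁ ≡ y₁ × toℕ y₂ ≡ suc (toℕ x₂) × x₃ ≡ y₃
  (x₁ , x₂ , x₃) ⋖[ Fin.suc (Fin.suc Fin.zero) ] (y₁ , y₂ , y₃) = x₁ ≡ y₁ × x₂ ≡ y₂ × toℕ y₃ ≡ suc (toℕ x₃)

  _⋖_ : Pt → Pt → Set
  x ⋖ y = ∃ λ d → x ⋖[ d ] y

  ⋖⇒≤P : ∀ {x y} → x ⋖ y → x ≤P y
  ⋖⇒≤P (Fin.zero , e , refl , refl) = suc≡⇒≤ e , ℕₚ.≤-refl , ℕₚ.≤-refl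
  ⋖⇒≤P (Fin.suc Fin.zero , refl , e , refl) = ℕₚ.≤-refl , suc≡⇒≤ e , ℕₚ.≤-refl
  ⋖⇒≤P (Fin.suc (Fin.suc Fin.zero) , refl , refl , e) = ℕₚ.≤-refl , ℕₚ.≤-refl , suc≡⇒≤ e

  ⋖-irrefl : ∀ {x y} → x ⋖ y → x ≢ y
  ⋖-irrefl (Fin.zero , e , _) refl = ℕₚ.1+n≢n (sym e)
  ⋖-irrefl (Fin.suc Fin.zero , _ , e , _) refl = ℕₚ.1+n≢n (sym e)
  ⋖-irrefl (Fin.suc (Fin.suc Fin.zero) , _ , _ , e) refl = ℕₚ.1+n≢n (sym e)

  ⋖-between-up : ∀ {x z} → x ≤P z → x ≢ z → ∃ λ y → x ⋖ y × y ≤P z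
  ⋖-between-up {x₁ , x₂ , x₃} {z₁ , z₂ , z₃} (l₁ , l₂ , l₃) x≢z
    with ℕₚ.m≤n⇒m<n∨m≡n l₁ | ℕₚ.m≤n⇒m<n∨m≡n l₂ | ℕₚ.m≤n⇒m<n∨m≡n l₃
  ... | inj₁ lt | _ | _ = let j , e , j≤ = successor-below x₁ z₁ lt in
    (j , x₂ , x₃) , (Fin.zero , e , refl , refl) , j≤ , l₂ , l₃
  ... | inj₂ _ | inj₁ lt | _ = let j , e , j≤ = successor-below x₂ z₂ lt in
    (x₁ , j , x₃) , (Fin.suc Fin.zero , refl , e , refl) , l₁ , j≤ , l₃
  ... | inj₂ _ | inj₂ _ | inj₁ lt = let j , e , j≤ = successor-below x₃ z₃ lt in
    (x₁ , x₂ , j) , (Fin.suc (Fin.suc Fin.zero) , refl , refl , e) , l₁ , l₂ , j≤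
  ... | inj₂ e₁ | inj₂ e₂ | inj₂ e₃ = ⊥-elim (x≢z (Pt-≡ e₁ e₂ e₃))

  ⋖-between-down : ∀ {x z} → x ≤P z → x ≢ z → ∃ λ y → y ⋖ z × x ≤P y
  ⋖-between-down {x₁ , x₂ , x₃} {z₁ , z₂ , z₃} (l₁ , l₂ , l₃) x≢z
    with ℕₚ.m≤n⇒m<n∨m≡n l₁ | ℕₚ.m≤n⇒m<n∨m≡n l₂ | ℕₚ.m≤n⇒m<n∨m≡n l₃
  ... | inj₁ lt | _ | _ = let j , e , ≤j = predecessor-above x₁ z₁ lt in
    (j , z₂ , z₃) , (Fin.zero , e , refl , refl) , ≤j , l₂ , l₃
  ... | inj₂ _ | inj₁ lt | _ = let j , e , ≤j = predecessor-above x₂ z₂ lt in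
    (z₁ , j , z₃) , (Fin.suc Fin.zero , refl , e , refl) , l₁ , ≤j , l₃
  ... | inj₂ _ | inj₂ _ | inj₁ lt = let j , e , ≤j = predecessor-above x₃ z₃ lt in
    (z₁ , z₂ , j) , (Fin.suc (Fin.suc Fin.zero) , refl , refl , e) , l₁ , l₂ , ≤j
  ... | inj₂ e₁ | inj₂ e₂ | inj₂ e₃ = ⊥-elim (x≢z (Pt-≡ e₁ e₂ e₃))

  Near : Pt → Pt → Set
  Near y q = q ≡ y ⊎ y ⋖ q ⊎ q ⋖ y

  AgreeNear : Pt → Subset → Subset → Set
  AgreeNear y R R′ = ∀ {q} → Near y q → R q ≡ R′ q

  sign : SignVec → Fin 3 → Sign
  sign ⟨ s , _ , _ ⟩ Fin.zero = s
  sign ⟨ _ , s , _ ⟩ (Fin.suc Fin.zero) = s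
  sign ⟨ _ , _ , s ⟩ (Fin.suc (Fin.suc Fin.zero)) = s

  levelIndex : SignVec → Pt → ℕ
  levelIndex ⟨ s₁ , s₂ , s₃ ⟩ x =
    shift s₁ (coord Fin.zero x) a₁ + shift s₂ (coord (Fin.suc Fin.zero) x) a₂
      + shift s₃ (coord (Fin.suc (Fin.suc Fin.zero)) x) a₃

  inner≡levelIndex : ∀ w x → inner x w ≡ + levelIndex w x ℤ.- + N
  inner≡levelIndex ⟨ s₁ , s₂ , s₃ ⟩ (x₁ , x₂ , x₃) = begin
    inner (x₁ , x₂ , x₃) ⟨ s₁ , s₂ , s₃ ⟩
      ≡⟨ cong₂ ℤ._+_ (cong₂ ℤ._+_ (sym (shift-signℤ s₁ (Finₚ.toℕ<n x₁)))
                                  (sym (shift-signℤ s₂ (Finₚ.toℕ<n x₂))))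
                     (sym (shift-signℤ s₃ (Finₚ.toℕ<n x₃))) ⟩
    (+ k₁ ℤ.- + a₁) ℤ.+ (+ k₂ ℤ.- + a₂) ℤ.+ (+ k₃ ℤ.- + a₃)
      ≡⟨ regroup (+ k₁) (+ k₂) (+ k₃) (+ a₁) (+ a₂) (+ a₃) ⟩
    (+ k₁ ℤ.+ + k₂ ℤ.+ + k₃) ℤ.- (+ a₁ ℤ.+ + a₂ ℤ.+ + a₃)
      ≡⟨ sym (cong₂ ℤ._-_ (pos-+₃ k₁ k₂ k₃) (pos-+₃ a₁ a₂ a₃)) ⟩
    + (k₁ + k₂ + k₃) ℤ.- + N ∎
    where
    open ≡-Reasoning
    k₁ = shift s₁ (suc (toℕ x₁)) a₁
    k₂ = shift s₂ (suc (toℕ x₂)) a₂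
    k₃ = shift s₃ (suc (toℕ x₃)) a₃
    regroup : ∀ k₁ k₂ k₃ b₁ b₂ b₃ →
      (k₁ ℤ.- b₁) ℤ.+ (k₂ ℤ.- b₂) ℤ.+ (k₃ ℤ.- b₃) ≡ (k₁ ℤ.+ k₂ ℤ.+ k₃) ℤ.- (b₁ ℤ.+ b₂ ℤ.+ b₃)
    regroup = solve-∀
    pos-+₃ : ∀ a b c → + (a + b + c) ≡ + a ℤ.+ + b ℤ.+ + c
    pos-+₃ a b c = trans (ℤₚ.pos-+ (a + b) c) (cong (ℤ._+ + c) (ℤₚ.pos-+ a b))

  levelIndex≤2N : ∀ w x → levelIndex w x ≤ 2 ℕ.* N
  levelIndex≤2N ⟨ s₁ , s₂ , s₃ ⟩ (x₁ , x₂ , x₃) = ℕₚ.≤-trans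
    (ℕₚ.+-mono-≤ (ℕₚ.+-mono-≤ (shift≤ s₁ (Finₚ.toℕ<n x₁)) (shift≤ s₂ (Finₚ.toℕ<n x₂)))
                 (shift≤ s₃ (Finₚ.toℕ<n x₃)))
    (ℕₚ.≤-reflexive (double a₁ a₂ a₃))
    where
    double : ∀ a b c → (a + a) + (b + b) + (c + c) ≡ 2 ℕ.* (a + b + c)
    double = ℕSolver.solve-∀

  ⋖-levelIndex : ∀ w d {x y} → x ⋖[ d ] y → Step (sign w d) (levelIndex w x) (levelIndex w y)
  ⋖-levelIndex ⟨ s₁ , s₂ , s₃ ⟩ Fin.zero {_ , x₂ , x₃} (e , refl , refl) =
    Step-+ʳ s₁ (shift s₃ (suc (toℕ x₃)) a₃) (Step-+ʳ s₁ (shift s₂ (suc (toℕ x₂)) a₂) (shift-Step s₁ e))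
  ⋖-levelIndex ⟨ s₁ , s₂ , s₃ ⟩ (Fin.suc Fin.zero) {x₁ , _ , x₃} (refl , e , refl) =
    Step-+ʳ s₂ (shift s₃ (suc (toℕ x₃)) a₃) (Step-+ˡ s₂ (shift s₁ (suc (toℕ x₁)) a₁) (shift-Step s₂ e))
  ⋖-levelIndex ⟨ s₁ , s₂ , s₃ ⟩ (Fin.suc (Fin.suc Fin.zero)) {x₁ , x₂ , _} (refl , refl , e) =
    Step-+ˡ s₃ (shift s₁ (suc (toℕ x₁)) a₁ + shift s₂ (suc (toℕ x₂)) a₂) (shift-Step s₃ e)

  ⋖-adjacent : ∀ w {x y} → x ⋖ y →
    levelIndex w y ≡ suc (levelIndex w x) ⊎ levelIndex w x ≡ suc (levelIndex w y)
  ⋖-adjacent w (d , c) = Step-adjacent (sign w d) (⋖-levelIndex w d c)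

  ⋖-levelIndex-≢ : ∀ w {x y} → x ⋖ y → levelIndex w x ≢ levelIndex w y
  ⋖-levelIndex-≢ w x⋖y e with ⋖-adjacent w x⋖y
  ... | inj₁ up = ℕₚ.1+n≢n (trans (sym up) (sym e))
  ... | inj₂ down = ℕₚ.1+n≢n (trans (sym down) e)

  Near-levelIndex : ∀ w {y q} → Near y q →
    levelIndex w q ≡ suc (levelIndex w y) ⊎ levelIndex w q ≤ levelIndex w y
  Near-levelIndex w (inj₁ refl) = inj₂ ℕₚ.≤-refl
  Near-levelIndex w (inj₂ (inj₁ y⋖q)) with ⋖-adjacent w y⋖q
  ... | inj₁ up = inj₁ up
  ... | inj₂ down = inj₂ (suc≡⇒≤ down)
  Near-levelIndex w (inj₂ (inj₂ q⋖y)) with ⋖-adjacent w q⋖y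
  ... | inj₁ down = inj₂ (suc≡⇒≤ down)
  ... | inj₂ up = inj₁ up

  top-down-induction : ∀ w (P : Pt → Set) →
    (∀ y → (∀ q → levelIndex w q ≡ suc (levelIndex w y) → P q) → P y) → ∀ y → P y
  top-down-induction w P step y = go (suc (2 ℕ.* N)) y (s≤s (ℕₚ.m≤m+n _ _))
    where
    go : ∀ n y → 2 ℕ.* N < n + levelIndex w y → P y
    go zero y bound = ⊥-elim (ℕₚ.<⇒≱ bound (levelIndex≤2N w y))
    go (suc n) y bound = step y λ q up →
      go n q (subst (λ m → 2 ℕ.* N < n + m) (sym up) (subst (2 ℕ.* N <_) (sym (ℕₚ.+-suc n _)) bound))

  -- In the sweep of Pro w, a neighbour q of y is toggled before y iff rise w y q ≡ 1.
  rise : SignVec → Pt → Pt → ℕ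
  rise w y q = if ⌊ levelIndex w q ℕ.≟ suc (levelIndex w y) ⌋ then 1 else 0

  rise-up : ∀ w {y q} → levelIndex w q ≡ suc (levelIndex w y) → rise w y q ≡ 1
  rise-up w {y} {q} up rewrite ⌊⌋-true (levelIndex w q ℕ.≟ suc (levelIndex w y)) up = refl

  rise-≤ : ∀ w {y q} → levelIndex w q ≤ levelIndex w y → rise w y q ≡ 0
  rise-≤ w {y} {q} q≤y rewrite ⌊⌋-false (levelIndex w q ℕ.≟ suc (levelIndex w y))
                                 (λ up → ℕₚ.<⇒≱ (ℕₚ.≤-reflexive (sym up)) q≤y) = refl

  toggle-≢ : ∀ x R {y} → y ≢ x → toggle x R y ≡ R y
  toggle-≢ x R {y} y≢x with R x
  ... | false with isOrderIdealᵇ (insert x R)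
  ...   | true rewrite ≢⇒≟P y x y≢x = ∨-identityʳ (R y)
  ...   | false = refl
  toggle-≢ x R {y} y≢x | true with isOrderIdealᵇ (remove x R)
  ...   | true rewrite ≢⇒≟P y x y≢x = ∧-identityʳ (R y)
  ...   | false = refl

  toggle-absent : ∀ x R → R x ≡ false → toggle x R x ≡ isOrderIdealᵇ (insert x R)
  toggle-absent x R _ with R x in Rx
  ... | false with isOrderIdealᵇ (insert x R)
  ...   | true  = trans (cong (_∨ (x ≟P x)) Rx) (≟P-refl x)
  ...   | false = Rx

  toggle-present : ∀ x R → R x ≡ true → toggle x R x ≡ not (isOrderIdealᵇ (remove x R))
  toggle-present x R _ with R x in Rx
  ... | true with isOrderIdealᵇ (remove x R)
  ...   | true  = trans (cong (_∧ not (x ≟P x)) Rx) (cong not (≟P-refl x))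
  ...   | false = Rx

  toggle-ideal : ∀ x {R} → IsOrderIdeal R → IsOrderIdeal (toggle x R)
  toggle-ideal x {R} R-ideal with R x
  ... | false with isOrderIdealᵇ (insert x R) in ok
  ...   | true  = Equivalence.to (isOrderIdealᵇ-reflects _) ok
  ...   | false = R-ideal
  toggle-ideal x {R} R-ideal | true with isOrderIdealᵇ (remove x R) in ok
  ...   | true  = Equivalence.to (isOrderIdealᵇ-reflects _) ok
  ...   | false = R-ideal

  insert-ideal⇔ : ∀ x {R} → IsOrderIdeal R → IsOrderIdeal (insert x R) ⇔ (∀ {c} → c ⋖ x → R c ≡ true)
  insert-ideal⇔ x {R} R-ideal = mk⇔
    (λ ideal {c} c⋖x → ∨-falseʳ (ideal c x (⋖⇒≤P c⋖x) x∈) (≢⇒≟P c x (⋖-irrefl c⋖x)))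
    (λ lowerIn a b a≤b b∈ → closed lowerIn a b a≤b b∈)
    where
    x∈ : insert x R x ≡ true
    x∈ = ∨-introʳ (≟P-refl x)
    closed : (∀ {c} → c ⋖ x → R c ≡ true) → IsOrderIdeal (insert x R)
    closed lowerIn a b a≤b b∈ with R b in Rb
    ... | true = ∨-introˡ (R-ideal a b a≤b Rb)
    ... | false with ≟P⇒≡ b x b∈ | a ≟Pt x
    ...   | refl | yes refl = x∈
    ...   | refl | no a≢x = let c , c⋖x , a≤c = ⋖-between-down a≤b a≢x in
      ∨-introˡ (R-ideal a c a≤c (lowerIn c⋖x))

  remove-ideal⇔ : ∀ x {R} → IsOrderIdeal R → IsOrderIdeal (remove x R) ⇔ (∀ {u} → x ⋖ u → R u ≡ false)
  remove-ideal⇔ x {R} R-ideal = mk⇔ upperOut closed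
    where
    ∈-remove : ∀ {u} → R u ≡ true → u ≢ x → remove x R u ≡ true
    ∈-remove {u} Ru u≢x rewrite Ru | ≢⇒≟P u x u≢x = refl
    upperOut : IsOrderIdeal (remove x R) → ∀ {u} → x ⋖ u → R u ≡ false
    upperOut ideal {u} x⋖u with R u in Ru
    ... | false = refl
    ... | true with ideal x u (⋖⇒≤P x⋖u) (∈-remove Ru (λ u≡x → ⋖-irrefl x⋖u (sym u≡x)))
    ...   | x∈ rewrite ≟P-refl x | ∧-zeroʳ (R x) with x∈
    ...     | ()
    closed : (∀ {u} → x ⋖ u → R u ≡ false) → IsOrderIdeal (remove x R)
    closed upperOut a b a≤b b∈ with ∧-elim b∈
    ... | Rb , b∉ with a ≟Pt x
    ...   | no a≢x = ∈-remove (R-ideal a b a≤b Rb) a≢x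
    ...   | yes refl with ⋖-between-up a≤b (λ a≡b → not-≟P⇒≢ b a b∉ (sym a≡b))
    ...     | u , a⋖u , u≤b with trans (sym (R-ideal u b u≤b Rb)) (upperOut a⋖u)
    ...       | ()

  toggle-local : ∀ x {R R′} → IsOrderIdeal R → IsOrderIdeal R′ → AgreeNear x R R′ →
    toggle x R x ≡ toggle x R′ x
  toggle-local x {R} {R′} R-ideal R′-ideal agree = byCase (R x) refl
    where
    open ≡-Reasoning
    equiv : ∀ {S S′} {P P′ : Set} → IsOrderIdeal S ⇔ P → IsOrderIdeal S′ ⇔ P′ → P ⇔ P′ →
      isOrderIdealᵇ S ≡ true ⇔ isOrderIdealᵇ S′ ≡ true
    equiv {S} {S′} e e′ p = ⇔.trans (isOrderIdealᵇ-reflects S)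
      (⇔.trans e (⇔.trans p (⇔.trans (⇔.sym e′) (⇔.sym (isOrderIdealᵇ-reflects S′)))))
    lowerCovers : (∀ {c} → c ⋖ x → R c ≡ true) ⇔ (∀ {c} → c ⋖ x → R′ c ≡ true)
    lowerCovers = mk⇔ (λ h {_} c⋖x → trans (sym (agree (inj₂ (inj₂ c⋖x)))) (h c⋖x))
                      (λ h {_} c⋖x → trans (agree (inj₂ (inj₂ c⋖x))) (h c⋖x))
    upperCovers : (∀ {u} → x ⋖ u → R u ≡ false) ⇔ (∀ {u} → x ⋖ u → R′ u ≡ false)
    upperCovers = mk⇔ (λ h {_} x⋖u → trans (sym (agree (inj₂ (inj₁ x⋖u)))) (h x⋖u))
                      (λ h {_} x⋖u → trans (agree (inj₂ (inj₁ x⋖u))) (h x⋖u))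
    byCase : ∀ b → R x ≡ b → toggle x R x ≡ toggle x R′ x
    byCase false Rx = begin
      toggle x R x                ≡⟨ toggle-absent x R Rx ⟩
      isOrderIdealᵇ (insert x R)  ≡⟨ ⇔→≡ (equiv (insert-ideal⇔ x R-ideal)
                                                (insert-ideal⇔ x R′-ideal) lowerCovers) ⟩
      isOrderIdealᵇ (insert x R′) ≡⟨ toggle-absent x R′ (trans (sym (agree (inj₁ refl))) Rx) ⟨
      toggle x R′ x               ∎
    byCase true Rx = begin
      toggle x R x                      ≡⟨ toggle-present x R Rx ⟩
      not (isOrderIdealᵇ (remove x R))  ≡⟨ cong not (⇔→≡ (equiv (remove-ideal⇔ x R-ideal)
                                                              (remove-ideal⇔ x R′-ideal) upperCovers)) ⟩
      not (isOrderIdealᵇ (remove x R′)) ≡⟨ toggle-present x R′ (trans (sym (agree (inj₁ refl))) Rx) ⟨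
      toggle x R′ x                     ∎

  -- ¬ ∀ rather than ∃ in the first case: no search over the covers of x is needed.
  toggle-self-true : ∀ x {R} → IsOrderIdeal R → toggle x R x ≡ true →
    (R x ≡ true × ¬ (∀ {u} → x ⋖ u → R u ≡ false)) ⊎ (R x ≡ false × (∀ {c} → c ⋖ x → R c ≡ true))
  toggle-self-true x {R} R-ideal h = byCase (R x) refl
    where
    false≢true : false ≢ true
    false≢true ()
    byCase : ∀ b → R x ≡ b →
      (R x ≡ true × ¬ (∀ {u} → x ⋖ u → R u ≡ false)) ⊎ (R x ≡ false × (∀ {c} → c ⋖ x → R c ≡ true))
    byCase true Rx = inj₁ (Rx , λ upperOut → false≢true (subst (λ b → not b ≡ true)
      (Equivalence.from (isOrderIdealᵇ-reflects _) (Equivalence.from (remove-ideal⇔ x R-ideal) upperOut))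
      (trans (sym (toggle-present x R Rx)) h)))
    byCase false Rx = inj₂ (Rx , Equivalence.to (insert-ideal⇔ x R-ideal)
      (Equivalence.to (isOrderIdealᵇ-reflects _) (trans (sym (toggle-absent x R Rx)) h)))

  -- Promotion as a top-down sweep through the levels

  toggleWhere : (Pt → Bool) → List Pt → Subset → Subset
  toggleWhere sel xs S = foldr (λ x R → if sel x then toggle x R else R) S xs

  toggleWhere-ideal : ∀ sel xs {S} → IsOrderIdeal S → IsOrderIdeal (toggleWhere sel xs S)
  toggleWhere-ideal sel [] S-ideal = S-ideal
  toggleWhere-ideal sel (x ∷ xs) S-ideal with sel x
  ... | true = toggle-ideal x (toggleWhere-ideal sel xs S-ideal)
  ... | false = toggleWhere-ideal sel xs S-ideal

  toggleWhere-untouched : ∀ sel xs {S y} → (y ∈ xs → sel y ≡ false) → toggleWhere sel xs S y ≡ S y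
  toggleWhere-untouched sel [] _ = refl
  toggleWhere-untouched sel (x ∷ xs) {S} {y} unselected with sel x in selected
  ... | false = toggleWhere-untouched sel xs {S} (λ y∈ → unselected (there y∈))
  ... | true = trans (toggle-≢ x (toggleWhere sel xs S) y≢x)
                 (toggleWhere-untouched sel xs {S} (λ y∈ → unselected (there y∈)))
    where
    y≢x : y ≢ x
    y≢x refl with trans (sym selected) (unselected (here refl))
    ... | ()

  toggleWhere-selected : ∀ sel xs {S y} → Unique xs → IsOrderIdeal S → y ∈ xs → sel y ≡ true →
    (∀ {q} → y ⋖ q ⊎ q ⋖ y → sel q ≡ false) → toggleWhere sel xs S y ≡ toggle y S y
  toggleWhere-selected sel (x ∷ xs) {S} (x∉ ∷ _) S-ideal (here refl) selected isolated rewrite selected =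
    toggle-local x (toggleWhere-ideal sel xs S-ideal) S-ideal agree
    where
    agree : AgreeNear x (toggleWhere sel xs S) S
    agree (inj₁ refl) = toggleWhere-untouched sel xs {S} (λ x∈ → ⊥-elim (All.lookup x∉ x∈ refl))
    agree (inj₂ neighbour) = toggleWhere-untouched sel xs {S} (λ _ → isolated neighbour)
  toggleWhere-selected sel (x ∷ xs) {S} (x∉ ∷ xs!) S-ideal (there y∈) selected isolated with sel x
  ... | false = toggleWhere-selected sel xs xs! S-ideal y∈ selected isolated
  ... | true = trans (toggle-≢ x (toggleWhere sel xs S) (λ { refl → All.lookup x∉ y∈ refl }))
                 (toggleWhere-selected sel xs xs! S-ideal y∈ selected isolated)

  atLevel : SignVec → ℤ → Pt → Bool
  atLevel w i x = ⌊ inner x w ℤ.≟ i ⌋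

  level-selected : ∀ w x k → atLevel w (+ k ℤ.- + N) x ≡ ⌊ levelIndex w x ℕ.≟ k ⌋
  level-selected w x k with inner x w ℤ.≟ + k ℤ.- + N | levelIndex w x ℕ.≟ k
  ... | yes _ | yes _ = refl
  ... | no _  | no _  = refl
  ... | yes e | no x∉k =
    ⊥-elim (x∉k (ℤₚ.+-injective (∙-cancelʳ (- + N) _ _ (trans (sym (inner≡levelIndex w x)) e))))
  ... | no x∉k | yes refl = ⊥-elim (x∉k (inner≡levelIndex w x))

  T-ideal : ∀ w i {S} → IsOrderIdeal S → IsOrderIdeal (T w i S)
  T-ideal w i = toggleWhere-ideal (atLevel w i) elems

  T-off : ∀ w k {S y} → levelIndex w y ≢ k → T w (+ k ℤ.- + N) S y ≡ S y
  T-off w k {S} {y} y∉k =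
    toggleWhere-untouched (atLevel w (+ k ℤ.- + N)) elems {S}
      (λ _ → trans (level-selected w y k) (⌊⌋-false (levelIndex w y ℕ.≟ k) y∉k))

  T-on : ∀ w k {S y} → IsOrderIdeal S → levelIndex w y ≡ k → T w (+ k ℤ.- + N) S y ≡ toggle y S y
  T-on w k {y = y} S-ideal y∈k =
    toggleWhere-selected (atLevel w (+ k ℤ.- + N)) elems elems-unique S-ideal (∈-elems y)
    (trans (level-selected w y k) (⌊⌋-true (levelIndex w y ℕ.≟ k) y∈k))
    λ {q} neighbour → trans (level-selected w q k) (⌊⌋-false (levelIndex w q ℕ.≟ k) (λ q∈k →
      levelIndex-≢ neighbour (trans q∈k (sym y∈k))))
    where
    levelIndex-≢ : ∀ {q} → y ⋖ q ⊎ q ⋖ y → levelIndex w q ≢ levelIndex w y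
    levelIndex-≢ (inj₁ y⋖q) e = ⋖-levelIndex-≢ w y⋖q (sym e)
    levelIndex-≢ (inj₂ q⋖y) = ⋖-levelIndex-≢ w q⋖y

  -- Pro w = sweep w (upTo (suc (2 ℕ.* N))) definitionally; the last level of ks is toggled first.
  sweep : SignVec → List ℕ → Subset → Subset
  sweep w ks A = foldr (λ k → T w (+ k ℤ.- + N)) A ks

  sweep-ideal : ∀ w ks {A} → IsOrderIdeal A → IsOrderIdeal (sweep w ks A)
  sweep-ideal w [] A-ideal = A-ideal
  sweep-ideal w (k ∷ ks) A-ideal = T-ideal w (+ k ℤ.- + N) (sweep-ideal w ks A-ideal)

  sweep-off : ∀ w ks {A y} → levelIndex w y ∉ ks → sweep w ks A y ≡ A y
  sweep-off w [] _ = refl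
  sweep-off w (k ∷ ks) {A} y∉ =
    trans (T-off w k (λ e → y∉ (here e))) (sweep-off w ks {A} (λ y∈ → y∉ (there y∈)))

  sweep-as-toggle : ∀ w ks {A} → AllPairs _<_ ks → IsOrderIdeal A → ∀ {y} → levelIndex w y ∈ ks →
    Σ[ R ∈ Subset ] IsOrderIdeal R × sweep w ks A y ≡ toggle y R y ×
      AgreeNear y R (λ q → iter (rise w y q) (sweep w ks) A q)
  sweep-as-toggle w (k ∷ ks) {A} (k< ∷ _) A-ideal {y} (here refl) =
    sweep w ks A , sweep-ideal w ks A-ideal , T-on w k (sweep-ideal w ks A-ideal) refl , agree
    where
    agree : AgreeNear y (sweep w ks A) (λ q → iter (rise w y q) (sweep w (k ∷ ks)) A q)
    agree {q} near with levelIndex w q ℕ.≟ suc (levelIndex w y) | Near-levelIndex w near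
    ... | yes up | _ = sym (T-off w k (λ e → ℕₚ.1+n≢n (trans (sym up) e)))
    ... | no ¬up | inj₁ up = ⊥-elim (¬up up)
    ... | no _ | inj₂ q≤y = sweep-off w ks (λ q∈ → ℕₚ.<⇒≱ (All.lookup k< q∈) q≤y)
  sweep-as-toggle w (k ∷ ks) {A} (k< ∷ sorted) A-ideal {y} (there y∈)
    with sweep-as-toggle w ks sorted A-ideal y∈
  ... | R , R-ideal , y≡ , agree =
    R , R-ideal , trans (T-off w k y∉k) y≡ , λ near → trans (agree near) (unchanged _)
    where
    k<y : k < levelIndex w y
    k<y = All.lookup k< y∈
    y∉k : levelIndex w y ≢ k
    y∉k e = ℕₚ.<-irrefl (sym e) k<y
    unchanged : ∀ q → iter (rise w y q) (sweep w ks) A q ≡ iter (rise w y q) (sweep w (k ∷ ks)) A q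
    unchanged q with levelIndex w q ℕ.≟ suc (levelIndex w y)
    ... | yes up = sym (T-off w k (λ e → ℕₚ.<⇒≱ k<y (suc≡⇒≤ (trans (sym e) up))))
    ... | no _ = refl

  Pro-ideal : ∀ w {A} → IsOrderIdeal A → IsOrderIdeal (Pro w A)
  Pro-ideal w = sweep-ideal w (upTo (suc (2 ℕ.* N)))

  Pro-as-toggle : ∀ w {A} → IsOrderIdeal A → ∀ y →
    Σ[ R ∈ Subset ] IsOrderIdeal R × Pro w A y ≡ toggle y R y ×
      AgreeNear y R (λ q → iter (rise w y q) (Pro w) A q)
  Pro-as-toggle w A-ideal y = sweep-as-toggle w (upTo (suc (2 ℕ.* N)))
    (AllPairsₚ.applyUpTo⁺₁ id _ (λ i<j _ → i<j)) A-ideal (∈ₚ.∈-upTo⁺ (s≤s (levelIndex≤2N w y)))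

  -- Δ³ and the comparison of Pro_(1,1,-1) with rowmotion

  iter-suc : ∀ n (f : Subset → Subset) S → iter n f (f S) ≡ iter (suc n) f S
  iter-suc zero f S = refl
  iter-suc (suc n) f S = cong f (iter-suc n f S)

  iter-+ : ∀ m n (f : Subset → Subset) S → iter m f (iter n f S) ≡ iter (m + n) f S
  iter-+ zero n f S = refl
  iter-+ (suc m) n f S = cong f (iter-+ m n f S)

  iter-ideal : ∀ {f} → (∀ {A} → IsOrderIdeal A → IsOrderIdeal (f A)) →
    ∀ n {A} → IsOrderIdeal A → IsOrderIdeal (iter n f A)
  iter-ideal f-ideal zero A-ideal = A-ideal
  iter-ideal f-ideal (suc n) A-ideal = f-ideal (iter-ideal f-ideal n A-ideal)

  Δ-eval : ∀ γ v S y → Δ γ v S y ≡ iter (pred (coord γ y)) (Pro v) S y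
  Δ-eval γ v S y = any-upTo-select (λ k → iter k (Pro v) S y) (coord-pos γ) (coord≤size γ)
    where
    coord-pos : ∀ γ → 0 < coord γ y
    coord-pos Fin.zero = s≤s z≤n
    coord-pos (Fin.suc Fin.zero) = s≤s z≤n
    coord-pos (Fin.suc (Fin.suc Fin.zero)) = s≤s z≤n
    coord≤size : ∀ γ → coord γ y ≤ size γ
    coord≤size Fin.zero = Finₚ.toℕ<n (proj₁ y)
    coord≤size (Fin.suc Fin.zero) = Finₚ.toℕ<n (proj₁ (proj₂ y))
    coord≤size (Fin.suc (Fin.suc Fin.zero)) = Finₚ.toℕ<n (proj₂ (proj₂ y))

  v⁺⁺⁺ v⁺⁺⁻ : SignVec
  v⁺⁺⁺ = ⟨ Sign.+ , Sign.+ , Sign.+ ⟩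
  v⁺⁺⁻ = ⟨ Sign.+ , Sign.+ , Sign.- ⟩

  ⋖-rises : ∀ {x y} → x ⋖ y → levelIndex v⁺⁺⁺ y ≡ suc (levelIndex v⁺⁺⁺ x)
  ⋖-rises (Fin.zero , x⋖y) = ⋖-levelIndex v⁺⁺⁺ Fin.zero x⋖y
  ⋖-rises (Fin.suc Fin.zero , x⋖y) = ⋖-levelIndex v⁺⁺⁺ (Fin.suc Fin.zero) x⋖y
  ⋖-rises (Fin.suc (Fin.suc Fin.zero) , x⋖y) = ⋖-levelIndex v⁺⁺⁺ (Fin.suc (Fin.suc Fin.zero)) x⋖y

  ideal-from-covers : ∀ {S} → (∀ {c x} → c ⋖ x → S x ≡ true → S c ≡ true) → IsOrderIdeal S
  ideal-from-covers {S} closed a = top-down-induction v⁺⁺⁺ Below step a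
    where
    Below : Pt → Set
    Below a = ∀ b → a ≤P b → S b ≡ true → S a ≡ true
    step : ∀ a → (∀ u → levelIndex v⁺⁺⁺ u ≡ suc (levelIndex v⁺⁺⁺ a) → Below u) → Below a
    step a IH b a≤b Sb with a ≟Pt b
    ... | yes refl = Sb
    ... | no a≢b = let u , a⋖u , u≤b = ⋖-between-up a≤b a≢b in closed a⋖u (IH u (⋖-rises a⋖u) b u≤b Sb)

  Pro⁺⁺⁺-below : ∀ {A} → IsOrderIdeal A → ∀ y → Pro v⁺⁺⁺ A y ≡ true → ∀ {z} → z ≤P y → z ≢ y → A z ≡ true
  Pro⁺⁺⁺-below {A} A-ideal = top-down-induction v⁺⁺⁺ _ step
    where
    step : ∀ y → (∀ u → levelIndex v⁺⁺⁺ u ≡ suc (levelIndex v⁺⁺⁺ y) →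
                   Pro v⁺⁺⁺ A u ≡ true → ∀ {z} → z ≤P u → z ≢ u → A z ≡ true) →
      Pro v⁺⁺⁺ A y ≡ true → ∀ {z} → z ≤P y → z ≢ y → A z ≡ true
    step y IH y∈ {z} z≤y z≢y with Pro-as-toggle v⁺⁺⁺ A-ideal y
    ... | R , R-ideal , y≡ , agree with toggle-self-true y R-ideal (trans (sym y≡) y∈)
    ...   | inj₂ (_ , lowerIn) =
      let c , c⋖y , z≤c = ⋖-between-down z≤y z≢y in
      A-ideal z c z≤c (subst (λ r → iter r (Pro v⁺⁺⁺) A c ≡ true) (rise-≤ v⁺⁺⁺ (suc≡⇒≤ (⋖-rises c⋖y)))
        (trans (sym (agree (inj₂ (inj₂ c⋖y)))) (lowerIn c⋖y)))
    ...   | inj₁ (_ , ¬upperOut) with A z in Az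
    ...     | true = refl
    ...     | false = ⊥-elim (¬upperOut upperOut)
      where
      upperOut : ∀ {u} → y ⋖ u → R u ≡ false
      upperOut {u} y⋖u with R u in Ru
      ... | false = refl
      ... | true with IH u (⋖-rises y⋖u)
                      (subst (λ r → iter r (Pro v⁺⁺⁺) A u ≡ true) (rise-up v⁺⁺⁺ (⋖-rises y⋖u))
                        (trans (sym (agree (inj₂ (inj₁ y⋖u)))) Ru))
                      (≤P-trans z≤y (⋖⇒≤P y⋖u))
                      (λ { refl → ⋖-irrefl y⋖u (≤P-antisym (⋖⇒≤P y⋖u) z≤y) })
      ...   | z∈ with trans (sym Az) z∈
      ...     | ()

  γ₃ : Fin 3
  γ₃ = Fin.suc (Fin.suc Fin.zero)

  index₃ : Pt → ℕ
  index₃ y = pred (coord γ₃ y)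

  Δ₃-ideal : ∀ {I} → IsOrderIdeal I → IsOrderIdeal (Δ γ₃ v⁺⁺⁺ I)
  Δ₃-ideal {I} I-ideal = ideal-from-covers λ {c} {y} c⋖y y∈ →
    trans (Δ-eval γ₃ v⁺⁺⁺ I c) (closed c⋖y (trans (sym (Δ-eval γ₃ v⁺⁺⁺ I y)) y∈))
    where
    iterPro-ideal : ∀ n → IsOrderIdeal (iter n (Pro v⁺⁺⁺) I)
    iterPro-ideal n = iter-ideal (Pro-ideal v⁺⁺⁺) n I-ideal
    closed : ∀ {c y} → c ⋖ y → iter (index₃ y) (Pro v⁺⁺⁺) I y ≡ true → iter (index₃ c) (Pro v⁺⁺⁺) I c ≡ true
    closed {c} {y} c⋖y@(Fin.zero , _ , _ , refl) = iterPro-ideal (index₃ y) c y (⋖⇒≤P c⋖y)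
    closed {c} {y} c⋖y@(Fin.suc Fin.zero , _ , _ , refl) = iterPro-ideal (index₃ y) c y (⋖⇒≤P c⋖y)
    closed {c} {y} c⋖y@(Fin.suc (Fin.suc Fin.zero) , refl , refl , e) y∈ =
      Pro⁺⁺⁺-below (iterPro-ideal (index₃ c)) y (subst (λ n → iter n (Pro v⁺⁺⁺) I y ≡ true) e y∈)
        (⋖⇒≤P c⋖y) (⋖-irrefl c⋖y)

  -- Reversing the third sign turns the z-neighbour above y into one below it and vice versa;
  -- Δ compensates with one more, resp. one fewer, application of Pro v⁺⁺⁺.
  rise-balance : ∀ {y q} → Near y q → rise v⁺⁺⁻ y q + index₃ q ≡ rise v⁺⁺⁺ y q + index₃ y
  rise-balance {y} (inj₁ refl)
    rewrite rise-≤ v⁺⁺⁻ {y} {y} ℕₚ.≤-refl | rise-≤ v⁺⁺⁺ {y} {y} ℕₚ.≤-refl = refl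
  rise-balance (inj₂ (inj₁ (Fin.zero , y⋖q@(_ , _ , refl))))
    rewrite rise-up v⁺⁺⁻ (⋖-levelIndex v⁺⁺⁻ Fin.zero y⋖q)
          | rise-up v⁺⁺⁺ (⋖-levelIndex v⁺⁺⁺ Fin.zero y⋖q) = refl
  rise-balance (inj₂ (inj₁ (Fin.suc Fin.zero , y⋖q@(_ , _ , refl))))
    rewrite rise-up v⁺⁺⁻ (⋖-levelIndex v⁺⁺⁻ (Fin.suc Fin.zero) y⋖q)
          | rise-up v⁺⁺⁺ (⋖-levelIndex v⁺⁺⁺ (Fin.suc Fin.zero) y⋖q) = refl
  rise-balance (inj₂ (inj₁ (Fin.suc (Fin.suc Fin.zero) , y⋖q@(_ , _ , e))))
    rewrite rise-≤ v⁺⁺⁻ (suc≡⇒≤ (⋖-levelIndex v⁺⁺⁻ γ₃ y⋖q)) | rise-up v⁺⁺⁺ (⋖-levelIndex v⁺⁺⁺ γ₃ y⋖q) = e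
  rise-balance (inj₂ (inj₂ (Fin.zero , q⋖y@(_ , _ , refl))))
    rewrite rise-≤ v⁺⁺⁻ (suc≡⇒≤ (⋖-levelIndex v⁺⁺⁻ Fin.zero q⋖y))
          | rise-≤ v⁺⁺⁺ (suc≡⇒≤ (⋖-levelIndex v⁺⁺⁺ Fin.zero q⋖y)) = refl
  rise-balance (inj₂ (inj₂ (Fin.suc Fin.zero , q⋖y@(_ , _ , refl))))
    rewrite rise-≤ v⁺⁺⁻ (suc≡⇒≤ (⋖-levelIndex v⁺⁺⁻ (Fin.suc Fin.zero) q⋖y))
          | rise-≤ v⁺⁺⁺ (suc≡⇒≤ (⋖-levelIndex v⁺⁺⁺ (Fin.suc Fin.zero) q⋖y)) = refl
  rise-balance (inj₂ (inj₂ (Fin.suc (Fin.suc Fin.zero) , q⋖y@(_ , _ , e))))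
    rewrite rise-up v⁺⁺⁻ (⋖-levelIndex v⁺⁺⁻ γ₃ q⋖y) | rise-≤ v⁺⁺⁺ (suc≡⇒≤ (⋖-levelIndex v⁺⁺⁺ γ₃ q⋖y)) = sym e

  Pro⁺⁺⁻-Δ₃ : ∀ {I} → IsOrderIdeal I → ∀ y →
    Pro v⁺⁺⁻ (Δ γ₃ v⁺⁺⁺ I) y ≡ iter (index₃ y) (Pro v⁺⁺⁺) (Pro v⁺⁺⁺ I) y
  Pro⁺⁺⁻-Δ₃ {I} I-ideal = top-down-induction v⁺⁺⁻ _ step
    where
    open ≡-Reasoning
    step : ∀ y → (∀ q → levelIndex v⁺⁺⁻ q ≡ suc (levelIndex v⁺⁺⁻ y) →
                   Pro v⁺⁺⁻ (Δ γ₃ v⁺⁺⁺ I) q ≡ iter (index₃ q) (Pro v⁺⁺⁺) (Pro v⁺⁺⁺ I) q) →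
      Pro v⁺⁺⁻ (Δ γ₃ v⁺⁺⁺ I) y ≡ iter (index₃ y) (Pro v⁺⁺⁺) (Pro v⁺⁺⁺ I) y
    step y IH with Pro-as-toggle v⁺⁺⁻ (Δ₃-ideal I-ideal) y
                 | Pro-as-toggle v⁺⁺⁺ (iter-ideal (Pro-ideal v⁺⁺⁺) (index₃ y) I-ideal) y
    ... | Rₗ , Rₗ-ideal , y≡ₗ , agreeₗ | Rᵣ , Rᵣ-ideal , y≡ᵣ , agreeᵣ = begin
      Pro v⁺⁺⁻ (Δ γ₃ v⁺⁺⁺ I) y                    ≡⟨ y≡ₗ ⟩
      toggle y Rₗ y                               ≡⟨ toggle-local y Rₗ-ideal Rᵣ-ideal agree ⟩
      toggle y Rᵣ y                               ≡⟨ y≡ᵣ ⟨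
      Pro v⁺⁺⁺ (iter (index₃ y) (Pro v⁺⁺⁺) I) y   ≡⟨ cong-app (iter-suc (index₃ y) (Pro v⁺⁺⁺) I) y ⟨
      iter (index₃ y) (Pro v⁺⁺⁺) (Pro v⁺⁺⁺ I) y   ∎
      where
      earlier : ∀ q → iter (rise v⁺⁺⁻ y q) (Pro v⁺⁺⁻) (Δ γ₃ v⁺⁺⁺ I) q ≡
                      iter (rise v⁺⁺⁻ y q + index₃ q) (Pro v⁺⁺⁺) I q
      earlier q with levelIndex v⁺⁺⁻ q ℕ.≟ suc (levelIndex v⁺⁺⁻ y)
      ... | yes up = trans (IH q up) (cong-app (iter-suc (index₃ q) (Pro v⁺⁺⁺) I) q)
      ... | no _ = Δ-eval γ₃ v⁺⁺⁺ I q
      agree : AgreeNear y Rₗ Rᵣ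
      agree {q} near = begin
        Rₗ q
          ≡⟨ agreeₗ near ⟩
        iter (rise v⁺⁺⁻ y q) (Pro v⁺⁺⁻) (Δ γ₃ v⁺⁺⁺ I) q
          ≡⟨ earlier q ⟩
        iter (rise v⁺⁺⁻ y q + index₃ q) (Pro v⁺⁺⁺) I q
          ≡⟨ cong (λ n → iter n (Pro v⁺⁺⁺) I q) (rise-balance near) ⟩
        iter (rise v⁺⁺⁺ y q + index₃ y) (Pro v⁺⁺⁺) I q
          ≡⟨ cong-app (iter-+ (rise v⁺⁺⁺ y q) (index₃ y) (Pro v⁺⁺⁺) I) q ⟨
        iter (rise v⁺⁺⁺ y q) (Pro v⁺⁺⁺) (iter (index₃ y) (Pro v⁺⁺⁺) I) q
          ≡⟨ agreeᵣ near ⟨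
        Rᵣ q ∎

corollary4p7 : (a₁ a₂ a₃ : ℕ) (I : Box.Subset a₁ a₂ a₃) → Box.IsOrderIdeal a₁ a₂ a₃ I →
    Box._≐_ a₁ a₂ a₃
      (Box.Pro a₁ a₂ a₃ ⟨ Sign.+ , Sign.+ , Sign.- ⟩ (Box.Δ a₁ a₂ a₃ (Fin.suc (Fin.suc Fin.zero)) ⟨ Sign.+ , Sign.+ , Sign.+ ⟩ I))
      (Box.Δ a₁ a₂ a₃ (Fin.suc (Fin.suc Fin.zero)) ⟨ Sign.+ , Sign.+ , Sign.+ ⟩ (Box.Pro a₁ a₂ a₃ ⟨ Sign.+ , Sign.+ , Sign.+ ⟩ I))
corollary4p7 a₁ a₂ a₃ I I-ideal x = trans (Pro⁺⁺⁻-Δ₃ I-ideal x) (sym (Δ-eval γ₃ v⁺⁺⁺ (Pro v⁺⁺⁺ I) x))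
  where
  open Box a₁ a₂ a₃
  open Properties a₁ a₂ a₃
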